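{- Let $\mathcal S$ be a Büchi automaton over $\Sigma$, let $a\in\mathit{Ag}$, let $\varphi$ be an LTL$^\sim$ formula, and let $\mathcal M$ be an $(\mathcal S,\varphi)$-monitor for $a$, with semantics $[\![\mathcal M]\!]$. Then for all $u\in\Sigma_a^+$ and $v\in\Sigma_a^*$ with $uv\in\mathit{Obs}_a(\mathcal S)$: if $[\![\mathcal M]\!](u)\in\{\mathsf{true},\mathsf{false}\}$, then $[\![\mathcal M]\!](uv)=[\![\mathcal M]\!](u)$.
   Context: Fix a finite set $\mathit{AP}$ of atomic propositions, $\Sigma=2^{\mathit{AP}}$, and a finite set $\mathit{Ag}$ of agents with observable propositions $\mathit{AP}_a\subseteq\mathit{AP}$ and $\Sigma_a=2^{\mathit{AP}_a}$. $\mathit{obs}_a(\sigma)=\sigma\cap\mathit{AP}_a$, extended letterwise to words; $w_{\le k}$ is the length-$k$ prefix of $w$. A Büchi automaton $\mathcal S$ over $\Sigma$ accepts $L(\mathcal S)\subseteq\Sigma^\omega$ (infinite words with a run from the initial state visiting accepting states infinitely often). $\mathit{Obs}_a(\mathcal S)=\{\mathit{obs}_a(u)\mid u\text{ a nonempty finite prefix of some word in }L(\mathcal S)\}$. LTL$^\sim$ formulas: $\varphi::=p\mid\neg\varphi\mid\varphi\wedge\varphi\mid\varphi\,\mathsf{U}^+\varphi\mid\varphi\,\mathsf{S}^+\varphi\mid\mathsf{K}_a\varphi$. For $w=\sigma_1\sigma_2\cdots\in L(\mathcal S)$, $k\ge1$: $p$ holds at $k$ iff $p\in\sigma_k$; Boolean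 cases as usual; $\varphi\,\mathsf U^+\psi$ holds at $k$ iff there is $j>k$ with $\psi$ at $j$ and $\varphi$ at all $k<i<j$; $\varphi\,\mathsf S^+\psi$ holds at $k$ iff there is $1\le j<k$ with $\psi$ at $j$ and $\varphi$ at all $j<i<k$; $\mathsf K_a\varphi$ holds at $k$ iff $\varphi$ holds at $k$ in every $w'\in L(\mathcal S)$ with $\mathit{obs}_a(w_{\le k})=\mathit{obs}_a(w'_{\le k})$. Derived: $\mathit{first}$ holds exactly at position 1, and $\mathsf P\varphi$ holds at $k$ iff $\varphi$ holds at some $1\le j\le k$. For $u\in\mathit{Obs}_a(\mathcal S)$ of length $k$, $\mathcal S,u\models_a\varphi$ iff $\varphi$ holds at position $k$ of every $w\in L(\mathcal S)$ with $\mathit{obs}_a(w_{\le k})=u$. Let $\hat\varphi=\mathsf P(\mathit{first}\wedge\varphi)$. A Moore machine over input $\Sigma_a$ and output $\Gamma$ is $(Q,\iota,\delta,\lambda)$ with finite $Q$, $\iota\in Q$, $\delta\colon Q\times\Sigma_a\to Q$, $\lambda\colon Q\to\Gamma$; its semantics is $[\![\mathcal M]\!](u)=\lambda(\delta^*(\iota,u))$. An $(\mathcal S,\varphi)$-monitor for $a$ is a Moore machine $\mathcal M$ over $\Sigma_a$ and $\Gamma=\{\mathsf{true},\mathsf{false},?\}$ such that for every $u\in\mathit{Obs}_a(\mathcal S)$, $[\![\mathcal M]\!](u)=\mathsf{true}$ if $\mathcal S,u\models_a\hat\varphi$, $=\mathsf{false}$ if $\mathcal S,u\models_a\neg\hat\varphi$,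 and $=?$ otherwise. -}

module Defs where

open import Data.Nat using (ℕ; zero; suc; _<_; _≤_; pred)
open import Data.Fin using (Fin)
open import Data.Bool using (Bool; true; false)
open import Data.Vec using (Vec; lookup; tabulate)
open import Data.List using (List; []; _∷_; map; length; foldl)
open import Data.List.Base using (upTo)
open import Data.Product using (Σ; ∃; ∃-syntax; _×_; _,_)
open import Data.Sum using (_⊎_)
open import Data.Empty using (⊥)
open import Relation.Binary.PropositionalEquality using (_≡_)
open import Function.Definitions using (Injective)
open import Relation.Nullary using (¬_)

-- The fixed setting: AP = Fin nAP, agents Ag = Fin nAg, and for each
-- agent a the observable propositions AP_a ⊆ AP, given as an injective
-- embedding  obsProp a : Fin (nObs a) → Fin nAP  (so AP_a ≅ Fin (nObs a)).

record Setting : Set where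
  field
    nAP      : ℕ
    nAg      : ℕ
    nObs     : Fin nAg → ℕ
    obsProp  : (a : Fin nAg) → Fin (nObs a) → Fin nAP
    obsProp-inj : (a : Fin nAg) → Injective _≡_ _≡_ (obsProp a)

module Over (𝒫 : Setting) where
  open Setting 𝒫

  AP : Set
  AP = Fin nAP

  Ag : Set
  Ag = Fin nAg

  -- Σ = 2^AP : a letter is the characteristic vector of a set of propositions
  Letter : Set
  Letter = Vec Bool nAP

  Letter_ : Ag → Set
  Letter_ a = Vec Bool (nObs a)

  -- obs_a(σ) = σ ∩ AP_a
  obs : (a : Ag) → Letter → Letter_ a
  obs a σ = tabulate (λ i → lookup σ (obsProp a i))

  -- infinite words over Σ; position k ≥ 1 of the paper is index k-1 here
  Word : Set
  Word = ℕ → Letter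

  prefix : Word → ℕ → List Letter
  prefix w k = map w (upTo k)

  obsWord : (a : Ag) → List Letter → List (Letter_ a)
  obsWord a = map (obs a)

  record Buchi : Set where
    field
      nQ     : ℕ
      init   : Fin nQ
      trans  : Fin nQ → Letter → Fin nQ → Bool
      accept : Fin nQ → Bool

  IsAcceptingRun : (S : Buchi) → Word → (ℕ → Fin (Buchi.nQ S)) → Set
  IsAcceptingRun S w r =
    (r 0 ≡ Buchi.init S)
    × (∀ i → Buchi.trans S (r i) (w i) (r (suc i)) ≡ true)
    × (∀ i → ∃[ j ] (i ≤ j × Buchi.accept S (r j) ≡ true))

  Lang : Buchi → Word → Set
  Lang S w = ∃[ r ] IsAcceptingRun S w r

  InObs : (S : Buchi) (a : Ag) → List (Letter_ a) → Set
  InObs S a u = ∃[ w ] (Lang S w × ∃[ k ] (u ≡ obsWord a (prefix w (suc k))))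

  data Formula : Set where
    atom : AP → Formula
    ¬'_  : Formula → Formula
    _∧'_ : Formula → Formula → Formula
    _U⁺_ : Formula → Formula → Formula
    _S⁺_ : Formula → Formula → Formula
    K    : Ag → Formula → Formula

  -- Semantics: Holds S φ w k  means φ holds at (paper) position k+1 of w.
  Holds : Buchi → Formula → Word → ℕ → Set
  Holds S (atom p)   w k = lookup (w k) p ≡ true
  Holds S (¬' φ)     w k = ¬ Holds S φ w k
  Holds S (φ ∧' ψ)   w k = Holds S φ w k × Holds S ψ w k
  Holds S (φ U⁺ ψ)   w k =
    ∃[ j ] (k < j × Holds S ψ w j × (∀ i → k < i → i < j → Holds S φ w i))
  Holds S (φ S⁺ ψ)   w k =
    ∃[ j ] (j < k × Holds S ψ w j × (∀ i → j < i → i < k → Holds S φ w i))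
  Holds S (K a φ)    w k =
    ∀ w' → Lang S w' →
      obsWord a (prefix w (suc k)) ≡ obsWord a (prefix w' (suc k)) →
      Holds S φ w' k

  -- derived operators (⊤ built from a given formula, since AP may be empty)
  _∨'_ : Formula → Formula → Formula
  φ ∨' ψ = ¬' ((¬' φ) ∧' (¬' ψ))

  ⊤from : Formula → Formula
  ⊤from φ = ¬' (φ ∧' (¬' φ))

  -- first holds exactly at position 1
  firstFrom : Formula → Formula
  firstFrom φ = ¬' (⊤from φ S⁺ ⊤from φ)

  -- P ψ holds at k iff ψ holds at some 1 ≤ j ≤ k
  Past : Formula → Formula
  Past ψ = ψ ∨' (⊤from ψ S⁺ ψ)

  hat : Formula → Formula
  hat φ = Past (firstFrom φ ∧' φ)

  -- S, u ⊨_a φ   (u nonempty, of length k; evaluated at position k)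
  Sat : (S : Buchi) (a : Ag) → List (Letter_ a) → Formula → Set
  Sat S a u φ =
    ∀ w → Lang S w → obsWord a (prefix w (length u)) ≡ u →
      Holds S φ w (pred (length u))

  data Verdict : Set where
    vtrue vfalse unknown : Verdict

  record Moore (I : Set) (Γ : Set) : Set where
    field
      nQ    : ℕ
      ι     : Fin nQ
      δ     : Fin nQ → I → Fin nQ
      out   : Fin nQ → Γ

  run : ∀ {I Γ} → Moore I Γ → List I → Γ
  run M u = Moore.out M (foldl (Moore.δ M) (Moore.ι M) u)

  IsMonitor : (S : Buchi) (φ : Formula) (a : Ag) →
              Moore (Letter_ a) Verdict → Set
  IsMonitor S φ a M =
    ∀ u → InObs S a u →
      (Sat S a u (hat φ) → run M u ≡ vtrue)
      × (Sat S a u (¬' hat φ) → run M u ≡ vfalse)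
      × (¬ Sat S a u (hat φ) → ¬ Sat S a u (¬' hat φ) → run M u ≡ unknown)

module Submission where

open import Defs
open import Data.Nat using (ℕ; zero; suc; _≤_; z≤n; s≤s)
open import Data.Nat.Properties using (pred-mono-≤)
open import Data.List using (List; []; _∷_; _++_; map; length; applyUpTo)
open import Data.List.Properties using (map-applyUpTo; map-upTo; ∷-injective)
open import Data.Product using (_,_; _×_; proj₁; proj₂)
open import Data.Sum using (_⊎_; inj₁; inj₂)
open import Function using (_∘_)
open import Relation.Nullary using (¬_; Dec; yes; no; ¬¬-map; contradiction)
open import Relation.Nullary.Decidable using (decidable-stable)
open import Relation.Binary.PropositionalEquality using (_≡_; refl; sym; trans; cong; cong₂; subst)

-- The formula φ̂ speaks only about the first position, so its truth value
-- is the same at every position of a word; hence so is that of ¬φ̂, and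
-- both S, u ⊨ₐ φ̂ and S, u ⊨ₐ ¬φ̂ persist when u is extended to an
-- observation uv.  A definite verdict of the monitor on u thus remains
-- justified on uv.  Constructively the verdict on u only yields ¬¬(S, u ⊨ₐ ψ),
-- which suffices because equality of verdicts is decidable.

applyUpTo-++⁻ : ∀ {A : Set} (f : ℕ → A) n (u v : List A) →
                applyUpTo f n ≡ u ++ v → length u ≤ n × applyUpTo f (length u) ≡ u
applyUpTo-++⁻ f n       []      v e = z≤n , refl
applyUpTo-++⁻ f (suc n) (x ∷ u) v e
  with f0≡x , rest ← ∷-injective e
  with u≤n , prefix-eq ← applyUpTo-++⁻ (f ∘ suc) n u v rest
  = s≤s u≤n , cong₂ _∷_ f0≡x prefix-eq

module _ (𝒫 : Setting) where
  open Over 𝒫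

  _≟ᵛ_ : (r s : Verdict) → Dec (r ≡ s)
  vtrue   ≟ᵛ vtrue   = yes refl
  vtrue   ≟ᵛ vfalse  = no λ ()
  vtrue   ≟ᵛ unknown = no λ ()
  vfalse  ≟ᵛ vtrue   = no λ ()
  vfalse  ≟ᵛ vfalse  = yes refl
  vfalse  ≟ᵛ unknown = no λ ()
  unknown ≟ᵛ vtrue   = no λ ()
  unknown ≟ᵛ vfalse  = no λ ()
  unknown ≟ᵛ unknown = yes refl

  obsWord-prefix : ∀ (a : Ag) w n → obsWord a (prefix w n) ≡ applyUpTo (obs a ∘ w) n
  obsWord-prefix a w n = trans (cong (map (obs a)) (map-upTo w n)) (map-applyUpTo w (obs a) n)

  obsWord-prefix-++⁻ : ∀ (a : Ag) w n (u v : List (Letter_ a)) →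
                       obsWord a (prefix w n) ≡ u ++ v →
                       length u ≤ n × obsWord a (prefix w (length u)) ≡ u
  obsWord-prefix-++⁻ a w n u v e
    with u≤n , prefix-eq ← applyUpTo-++⁻ (obs a ∘ w) n u v (trans (sym (obsWord-prefix a w n)) e)
    = u≤n , trans (obsWord-prefix a w (length u)) prefix-eq

  module _ (S : Buchi) where

    InObs-++⁻ : ∀ (a : Ag) x (u v : List (Letter_ a)) →
                InObs S a ((x ∷ u) ++ v) → InObs S a (x ∷ u)
    InObs-++⁻ a x u v (w , w∈L , k , e) =
      w , w∈L , length u , sym (proj₂ (obsWord-prefix-++⁻ a w (suc k) (x ∷ u) v (sym e)))

    Persistent : Formula → Set
    Persistent ψ = ∀ w {k k'} → k ≤ k' → Holds S ψ w k → Holds S ψ w k'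

    Sat-++⁺ : ∀ (a : Ag) {ψ} → Persistent ψ →
              ∀ (u v : List (Letter_ a)) → Sat S a u ψ → Sat S a (u ++ v) ψ
    Sat-++⁺ a persistent u v sat w w∈L e
      with u≤uv , prefix-eq ← obsWord-prefix-++⁻ a w (length (u ++ v)) u v e
      = persistent w (pred-mono-≤ u≤uv) (sat w w∈L prefix-eq)

    ⊤from-holds : ∀ ψ w k → Holds S (⊤from ψ) w k
    ⊤from-holds ψ w k (h , ¬h) = ¬h h

    firstFrom-at-zero : ∀ φ w k → Holds S (firstFrom φ) w k → k ≡ 0
    firstFrom-at-zero φ w zero    _     = refl
    firstFrom-at-zero φ w (suc k) first =
      contradiction (0 , s≤s z≤n , ⊤from-holds φ w 0 , λ i _ _ → ⊤from-holds φ w i) first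

    hat⇒¬¬initial : ∀ φ w k → Holds S (hat φ) w k → ¬ ¬ Holds S (firstFrom φ ∧' φ) w 0
    hat⇒¬¬initial φ w k hat-k ¬initial = hat-k (¬initial ∘ at-zero , λ (j , _ , h , _) → ¬initial (at-zero h))
      where
      at-zero : ∀ {j} → Holds S (firstFrom φ ∧' φ) w j → Holds S (firstFrom φ ∧' φ) w 0
      at-zero {j} h@(first , _) = subst (Holds S (firstFrom φ ∧' φ) w) (firstFrom-at-zero φ w j first) h

    ¬¬initial⇒hat : ∀ φ w k → ¬ ¬ Holds S (firstFrom φ ∧' φ) w 0 → Holds S (hat φ) w k
    ¬¬initial⇒hat φ w zero    ¬¬initial (¬now , _)   = ¬¬initial ¬now
    ¬¬initial⇒hat φ w (suc k) ¬¬initial (_ , ¬since) =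
      ¬¬initial λ initial → ¬since (0 , s≤s z≤n , initial , λ i _ _ → ⊤from-holds (firstFrom φ ∧' φ) w i)

    hat-persistent : ∀ φ → Persistent (hat φ)
    hat-persistent φ w {k} {k'} _ = ¬¬initial⇒hat φ w k' ∘ hat⇒¬¬initial φ w k

    ¬hat-persistent : ∀ φ → Persistent (¬' hat φ)
    ¬hat-persistent φ w {k} {k'} _ ¬hat-k = ¬hat-k ∘ ¬¬initial⇒hat φ w k ∘ hat⇒¬¬initial φ w k'

    module _ (φ : Formula) (a : Ag) (M : Moore (Letter_ a) Verdict) (monitor : IsMonitor S φ a M) where

      vtrue⇒¬¬Sat-hat : ∀ u → InObs S a u → run M u ≡ vtrue → ¬ ¬ Sat S a u (hat φ)
      vtrue⇒¬¬Sat-hat u u∈Obs e ¬sat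
        with _ , to-vfalse , to-unknown ← monitor u u∈Obs =
        contradiction (trans (sym (to-unknown ¬sat ¬sat¬)) e) λ ()
        where
        ¬sat¬ : ¬ Sat S a u (¬' hat φ)
        ¬sat¬ sat¬ = contradiction (trans (sym (to-vfalse sat¬)) e) λ ()

      vfalse⇒¬¬Sat-¬hat : ∀ u → InObs S a u → run M u ≡ vfalse → ¬ ¬ Sat S a u (¬' hat φ)
      vfalse⇒¬¬Sat-¬hat u u∈Obs e ¬sat¬
        with to-vtrue , _ , to-unknown ← monitor u u∈Obs =
        contradiction (trans (sym (to-unknown ¬sat ¬sat¬)) e) λ ()
        where
        ¬sat : ¬ Sat S a u (hat φ)
        ¬sat sat = contradiction (trans (sym (to-vtrue sat)) e) λ ()

      verdict-persists : ∀ ψ (t : Verdict) → Persistent ψ →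
                         (∀ u → InObs S a u → Sat S a u ψ → run M u ≡ t) →
                         ∀ (u v : List (Letter_ a)) → InObs S a (u ++ v) →
                         ¬ ¬ Sat S a u ψ → run M (u ++ v) ≡ t
      verdict-persists ψ t persistent sat⇒t u v uv∈Obs ¬¬sat =
        decidable-stable (run M (u ++ v) ≟ᵛ t)
          (¬¬-map (sat⇒t (u ++ v) uv∈Obs ∘ Sat-++⁺ a persistent u v) ¬¬sat)

      vtrue-persists : ∀ x (u v : List (Letter_ a)) → InObs S a ((x ∷ u) ++ v) →
                       run M (x ∷ u) ≡ vtrue → run M ((x ∷ u) ++ v) ≡ vtrue
      vtrue-persists x u v uv∈Obs e =
        verdict-persists (hat φ) vtrue (hat-persistent φ) (λ w w∈Obs → proj₁ (monitor w w∈Obs))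
          (x ∷ u) v uv∈Obs (vtrue⇒¬¬Sat-hat (x ∷ u) (InObs-++⁻ a x u v uv∈Obs) e)

      vfalse-persists : ∀ x (u v : List (Letter_ a)) → InObs S a ((x ∷ u) ++ v) →
                        run M (x ∷ u) ≡ vfalse → run M ((x ∷ u) ++ v) ≡ vfalse
      vfalse-persists x u v uv∈Obs e =
        verdict-persists (¬' hat φ) vfalse (¬hat-persistent φ) (λ w w∈Obs → proj₁ (proj₂ (monitor w w∈Obs)))
          (x ∷ u) v uv∈Obs (vfalse⇒¬¬Sat-¬hat (x ∷ u) (InObs-++⁻ a x u v uv∈Obs) e)

proposition5p7 : (𝒫 : Setting) (S : Over.Buchi 𝒫) (a : Over.Ag 𝒫) (φ : Over.Formula 𝒫)
    (M : Over.Moore 𝒫 (Over.Letter_ 𝒫 a) (Over.Verdict 𝒫)) →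
    Over.IsMonitor 𝒫 S φ a M →
    (x : Over.Letter_ 𝒫 a) (u' v : List (Over.Letter_ 𝒫 a)) →
    Over.InObs 𝒫 S a ((x ∷ u') ++ v) →
    (Over.run 𝒫 M (x ∷ u') ≡ Over.vtrue ⊎ Over.run 𝒫 M (x ∷ u') ≡ Over.vfalse) →
    Over.run 𝒫 M ((x ∷ u') ++ v) ≡ Over.run 𝒫 M (x ∷ u')
proposition5p7 𝒫 S a φ M monitor x u v uv∈Obs (inj₁ e) =
  trans (vtrue-persists 𝒫 S φ a M monitor x u v uv∈Obs e) (sym e)
proposition5p7 𝒫 S a φ M monitor x u v uv∈Obs (inj₂ e) =
  trans (vfalse-persists 𝒫 S φ a M monitor x u v uv∈Obs e) (sym e)
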